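{- Let $\mathcal{G}$ be a valued digraph and let $A,B\in IS(\mathcal{G})$ with $|A|=k$, $|B|=q$. If $A\subseteq B$, then there exists a peeling sequence $L=[x_1,x_2,\dots]$ of $\mathcal{G}$ with $A=\{x_1,\dots,x_k\}$ and $B=\{x_1,\dots,x_q\}$. Consequently, $(IS(\mathcal{G}),\subseteq)$ is graded with rank function $A\mapsto|A|$.
   Context: Valued digraph: pair $(G,\theta)$, $G=(V,E)$ simple acyclic digraph, $\theta:V\to\mathbb{N}$ with $0\le\theta(x)\le d^+(x)$ (out-degree). A vertex $x$ is erasable if $\theta(x)=0$ and every $z$ with $(z,x)\in E$ has $\theta(z)\ne0$. Peeling process: repeatedly choose an erasable vertex $x_i$ of the current valued digraph, delete it with its incident arcs, and decrease by $1$ the value of each $y$ with an arc $(y,x_i)$; stop when none remains. The resulting sequences are peeling sequences; $IS(\mathcal{G})$ consists of $\emptyset$ and the sets of first $k\ge1$ entries of peeling sequences. -}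

module Defs where

open import Data.Nat using (ℕ; zero; suc; _∸_; _≤_; _<_)
open import Data.Bool using (Bool; true; false; if_then_else_)
open import Data.Fin using (Fin; _≟_)
open import Data.Fin.Subset using (Subset; ⊥; ⁅_⁆; _∪_; _⊆_; ∣_∣)
open import Data.List using (List; []; _∷_; length; take; map; foldr)
open import Data.Nat.ListAction using (sum)
open import Data.List.Base using (allFin)
open import Data.Product using (Σ; _×_; _,_)
open import Data.Sum using (_⊎_)
open import Relation.Nullary using (¬_; does)
open import Relation.Binary.PropositionalEquality using (_≡_; _≢_)
open import Relation.Binary.Construct.Closure.Transitive using (TransClosure)

-- A simple acyclic digraph on vertex set Fin n: the arc relation is a
-- Bool-valued matrix (so no multiple arcs), with no loops and no directed
-- cycles (no vertex reaches itself by a nonempty directed path).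
Arc : ℕ → Set
Arc n = Fin n → Fin n → Bool

outdeg : ∀ {n} → Arc n → Fin n → ℕ
outdeg {n} E x = sum (map (λ y → if E x y then 1 else 0) (allFin n))

record ValuedDigraph : Set where
  field
    n        : ℕ
    E        : Arc n
    loopless : ∀ x → E x x ≡ false
    acyclic  : ∀ x → ¬ TransClosure (λ u v → E u v ≡ true) x x
    θ        : Fin n → ℕ
    θ≤d⁺     : ∀ x → θ x ≤ outdeg E x

open ValuedDigraph public

record State (n : ℕ) : Set where
  constructor st
  field
    alive : Fin n → Bool
    val   : Fin n → ℕ

open State public

initial : (G : ValuedDigraph) → State (n G)
initial G = st (λ _ → true) (θ G)

Erasable : (G : ValuedDigraph) → State (n G) → Fin (n G) → Set
Erasable G s x =
  alive s x ≡ true × val s x ≡ 0 ×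
  (∀ z → alive s z ≡ true → E G z x ≡ true → val s z ≢ 0)

delete : (G : ValuedDigraph) → State (n G) → Fin (n G) → State (n G)
delete G s x =
  st (λ y → if does (y ≟ x) then false else alive s y)
     (λ y → if E G y x then val s y ∸ 1 else val s y)

data Run (G : ValuedDigraph) : State (n G) → List (Fin (n G)) → State (n G) → Set where
  done : ∀ {s} → Run G s [] s
  step : ∀ {s x xs t} → Erasable G s x → Run G (delete G s x) xs t → Run G s (x ∷ xs) t

PeelingSequence : (G : ValuedDigraph) → List (Fin (n G)) → Set
PeelingSequence G L =
  Σ (State (n G)) λ t → Run G (initial G) L t × (∀ x → ¬ Erasable G t x)

setOf : ∀ {m} → List (Fin m) → Subset m
setOf = foldr (λ x s → ⁅ x ⁆ ∪ s) ⊥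

IS : (G : ValuedDigraph) → Subset (n G) → Set
IS G A =
  A ≡ ⊥ ⊎
  Σ (List (Fin (n G))) λ L → PeelingSequence G L ×
    Σ ℕ λ k → 1 ≤ k × k ≤ length L × A ≡ setOf (take k L)

Covers : (G : ValuedDigraph) → Subset (n G) → Subset (n G) → Set
Covers G A B =
  IS G A × IS G B × A ⊆ B × A ≢ B ×
  (∀ C → IS G C → A ⊆ C → C ⊆ B → C ≡ A ⊎ C ≡ B)

GradedBy : (G : ValuedDigraph) → (Subset (n G) → ℕ) → Set
GradedBy G ρ =
  (∀ A B → IS G A → IS G B → A ⊆ B → A ≢ B → ρ A < ρ B) ×
  (∀ A B → Covers G A B → ρ B ≡ suc (ρ A))

module Submission where

-- Deleting a set D of vertices from the valued digraph leaves
-- every remaining vertex y with value θ(y) − loss(y,D), where loss(y,D) is the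
-- number of out-neighbours of y in D; a run of the peeling process keeps its
-- state in this form ("D is reached", with no value ever truncated at 0).
-- The key fact (find-erasable) is: if D ⊆ T are reached and D ≠ T, some
-- vertex of T ∖ D is erasable after D.  Indeed the first vertex of T ∖ D
-- erased on the way to T is exhausted by D (its value after D is 0); if an
-- exhausted vertex is blocked by an alive in-neighbour of value 0, that
-- in-neighbour again lies in T ∖ D and is exhausted, and by acyclicity this
-- backward search ends at an erasable vertex.  Hence (extend) a run reaching A
-- can be continued until it reaches any B ⊇ A in IS(G), and then (complete)
-- until it stops, giving the common peeling sequence.  Gradedness follows:
-- proper inclusion increases cardinality, and if B covers A the prefix of
-- that sequence of length |A| + 1 lies between A and B, so it equals B.

open import Defs
open import Data.Nat using (ℕ; zero; suc; _+_; _∸_; _⊓_; _≤_; _<_; z≤n; s≤s)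
open import Data.Nat.Properties
  using (≤-pred; <⇒≤; m≤n⇒m<n∨m≡n; n<1+n; n≤1+n; ≤-trans; 1+n≰n; 1+n≢n;
         +-suc; +-comm; +-identityʳ; m≤n+m; ∸-+-assoc; m∸n≡0⇒m≤n; m≤n⇒m∸n≡0;
         m∸n≢0⇒n<m; m≤n⇒m⊓n≡m; m⊓n≤n)
import Data.Nat.Properties as ℕ
open import Data.Bool using (true; false)
import Data.Bool.Properties as Bool
open import Data.Fin using (Fin; zero; suc; toℕ; _≟_)
open import Data.Fin.Properties using (pigeonhole; toℕ<n; any?; all?)
open import Data.Fin.Subset
  using (Subset; outside; inside; ⊥; ⊤; ⁅_⁆; _∪_; _∩_; _∈_; _∉_; _⊆_; ∣_∣)
open import Data.Fin.Subset.Properties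
  using (_∈?_; ∈⊤; ∉⊥; ⊥⊆; ∣⊥∣≡0; ∣p∣≤n; x∈⁅x⁆; x∈⁅y⁆⇒x≡y; x∈p∪q⁺; x∈p∪q⁻;
         x∈p∩q⁺; x∈p∩q⁻; ∪-identityˡ; ∪-identityʳ; ∪-assoc; ∪-comm;
         ∩-identityˡ; ∩-zeroʳ; ⊆-antisym; p⊆q⇒∣p∣≤∣q∣; p⊂q⇒∣p∣<∣q∣)
open import Data.Vec using (_∷_; here; there; tabulate)
open import Data.Vec.Properties using (lookup∘tabulate; lookup⇒[]=; []=⇒lookup)
open import Data.List using (List; []; _∷_; _++_; take; length)
open import Data.List.Properties using (length-take; ++-assoc)
open import Data.Product using (∃; ∃₂; Σ; _×_; _,_; proj₁; proj₂)
open import Data.Sum using (_⊎_; inj₁; inj₂)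
open import Data.Unit using (tt) renaming (⊤ to ⊤′)
open import Data.Empty using (⊥-elim)
open import Relation.Nullary using (¬_; Dec; yes; no)
open import Relation.Nullary.Decidable using (_×-dec_; _→-dec_; ¬?)
open import Relation.Binary.PropositionalEquality
  using (_≡_; _≢_; refl; sym; trans; cong; subst; module ≡-Reasoning)
open import Relation.Binary.Construct.Closure.Transitive using (TransClosure; [_]; _∷_)

module _ {m : ℕ} where

  ⊆-or-witness : (p q : Subset m) → p ⊆ q ⊎ ∃ λ x → x ∈ p × x ∉ q
  ⊆-or-witness p q with any? (λ x → (x ∈? p) ×-dec ¬? (x ∈? q))
  ... | yes witness = inj₂ witness
  ... | no none     = inj₁ λ {x} x∈p → decide x x∈p
    where
    decide : ∀ x → x ∈ p → x ∈ q
    decide x x∈p with x ∈? q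
    ... | yes x∈q = x∈q
    ... | no  x∉q = ⊥-elim (none (x , x∈p , x∉q))

  ⊆∧≢⇒∣∣< : ∀ {p q : Subset m} → p ⊆ q → p ≢ q → ∣ p ∣ < ∣ q ∣
  ⊆∧≢⇒∣∣< {p} {q} p⊆q p≢q with ⊆-or-witness q p
  ... | inj₁ q⊆p     = ⊥-elim (p≢q (⊆-antisym p⊆q q⊆p))
  ... | inj₂ witness = p⊂q⇒∣p∣<∣q∣ (p⊆q , witness)

  ∈-insert : ∀ (x : Fin m) {p} → x ∈ ⁅ x ⁆ ∪ p
  ∈-insert x = x∈p∪q⁺ (inj₁ (x∈⁅x⁆ x))

  ∈-insert⁻ : ∀ {x y : Fin m} {p} → y ∈ ⁅ x ⁆ ∪ p → y ≡ x ⊎ y ∈ p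
  ∈-insert⁻ {x} {p = p} y∈ with x∈p∪q⁻ ⁅ x ⁆ p y∈
  ... | inj₁ y∈⁅x⁆ = inj₁ (x∈⁅y⁆⇒x≡y x y∈⁅x⁆)
  ... | inj₂ y∈p   = inj₂ y∈p

  insert-⊆ : ∀ {x : Fin m} {p q} → x ∈ q → p ⊆ q → ⁅ x ⁆ ∪ p ⊆ q
  insert-⊆ x∈q p⊆q y∈ with ∈-insert⁻ y∈
  ... | inj₁ refl = x∈q
  ... | inj₂ y∈p  = p⊆q y∈p

  ∉-insert : ∀ {x y : Fin m} {p} → y ≢ x → y ∉ p → y ∉ ⁅ x ⁆ ∪ p
  ∉-insert y≢x y∉p y∈ with ∈-insert⁻ y∈
  ... | inj₁ y≡x = y≢x y≡x
  ... | inj₂ y∈p = y∉p y∈p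

  ∉-insert⁻ : ∀ {x y : Fin m} {p} → y ∉ ⁅ x ⁆ ∪ p → y ≢ x × y ∉ p
  ∉-insert⁻ y∉ = (λ { refl → y∉ (∈-insert _) }) , (λ y∈p → y∉ (x∈p∪q⁺ (inj₂ y∈p)))

  insert-∪ : ∀ (x : Fin m) p q → (⁅ x ⁆ ∪ p) ∪ q ≡ p ∪ (⁅ x ⁆ ∪ q)
  insert-∪ x p q = trans (cong (_∪ q) (∪-comm ⁅ x ⁆ p)) (∪-assoc p ⁅ x ⁆ q)

  ∩-monoʳ-⊆ : ∀ {p q r : Subset m} → q ⊆ r → p ∩ q ⊆ p ∩ r
  ∩-monoʳ-⊆ {p} {q} q⊆r x∈ with x∈p∩q⁻ p q x∈
  ... | x∈p , x∈q = x∈p∩q⁺ (x∈p , q⊆r x∈q)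

∣p∩⁅x⁆∪q∣-∈ : ∀ {m} {x : Fin m} {p q} → x ∈ p → x ∉ q → ∣ p ∩ (⁅ x ⁆ ∪ q) ∣ ≡ suc ∣ p ∩ q ∣
∣p∩⁅x⁆∪q∣-∈ {q = outside ∷ q} here x∉q rewrite ∪-identityˡ q = refl
∣p∩⁅x⁆∪q∣-∈ {q = inside ∷ q}  here x∉q = ⊥-elim (x∉q here)
∣p∩⁅x⁆∪q∣-∈ {x = suc x} {outside ∷ p} {b ∷ q} (there x∈p) x∉q =
  ∣p∩⁅x⁆∪q∣-∈ x∈p (λ x∈q → x∉q (there x∈q))
∣p∩⁅x⁆∪q∣-∈ {x = suc x} {inside ∷ p} {outside ∷ q} (there x∈p) x∉q =
  ∣p∩⁅x⁆∪q∣-∈ x∈p (λ x∈q → x∉q (there x∈q))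
∣p∩⁅x⁆∪q∣-∈ {x = suc x} {inside ∷ p} {inside ∷ q} (there x∈p) x∉q =
  cong suc (∣p∩⁅x⁆∪q∣-∈ x∈p (λ x∈q → x∉q (there x∈q)))

∣p∩⁅x⁆∪q∣-∉ : ∀ {m} {x : Fin m} {p q} → x ∉ p → ∣ p ∩ (⁅ x ⁆ ∪ q) ∣ ≡ ∣ p ∩ q ∣
∣p∩⁅x⁆∪q∣-∉ {x = zero} {inside ∷ p} x∉p = ⊥-elim (x∉p here)
∣p∩⁅x⁆∪q∣-∉ {x = zero} {outside ∷ p} {b ∷ q} x∉p rewrite ∪-identityˡ q = refl
∣p∩⁅x⁆∪q∣-∉ {x = suc x} {outside ∷ p} {b ∷ q} x∉p =
  ∣p∩⁅x⁆∪q∣-∉ (λ x∈p → x∉p (there x∈p))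
∣p∩⁅x⁆∪q∣-∉ {x = suc x} {inside ∷ p} {outside ∷ q} x∉p =
  ∣p∩⁅x⁆∪q∣-∉ (λ x∈p → x∉p (there x∈p))
∣p∩⁅x⁆∪q∣-∉ {x = suc x} {inside ∷ p} {inside ∷ q} x∉p =
  cong suc (∣p∩⁅x⁆∪q∣-∉ (λ x∈p → x∉p (there x∈p)))

∣⁅x⁆∪p∣ : ∀ {m} {x : Fin m} {p} → x ∉ p → ∣ ⁅ x ⁆ ∪ p ∣ ≡ suc ∣ p ∣
∣⁅x⁆∪p∣ {x = x} {p} x∉p = begin
  ∣ ⁅ x ⁆ ∪ p ∣           ≡⟨ cong ∣_∣ (sym (∩-identityˡ (⁅ x ⁆ ∪ p))) ⟩
  ∣ ⊤ ∩ (⁅ x ⁆ ∪ p) ∣     ≡⟨ ∣p∩⁅x⁆∪q∣-∈ ∈⊤ x∉p ⟩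
  suc ∣ ⊤ ∩ p ∣           ≡⟨ cong (λ r → suc ∣ r ∣) (∩-identityˡ p) ⟩
  suc ∣ p ∣               ∎
  where open ≡-Reasoning

module _ {m : ℕ} where

  setOf-++ : (xs ys : List (Fin m)) → setOf (xs ++ ys) ≡ setOf xs ∪ setOf ys
  setOf-++ []       ys = sym (∪-identityˡ (setOf ys))
  setOf-++ (x ∷ xs) ys = trans (cong (⁅ x ⁆ ∪_) (setOf-++ xs ys)) (sym (∪-assoc ⁅ x ⁆ (setOf xs) (setOf ys)))

  setOf-take-mono : ∀ {i j} (xs : List (Fin m)) → i ≤ j → setOf (take i xs) ⊆ setOf (take j xs)
  setOf-take-mono xs       z≤n       = ⊥⊆
  setOf-take-mono []       (s≤s _)   = ⊥⊆
  setOf-take-mono (x ∷ xs) (s≤s i≤j) =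
    insert-⊆ (∈-insert x) (λ y∈ → x∈p∪q⁺ (inj₂ (setOf-take-mono xs i≤j y∈)))

take-length-++ : ∀ {A : Set} (xs ys : List A) → take (length xs) (xs ++ ys) ≡ xs
take-length-++ []       ys = refl
take-length-++ (x ∷ xs) ys = cong (x ∷_) (take-length-++ xs ys)

-- Descent in a finite acyclic relation R: if every P-element satisfies Q or
-- has an R-predecessor in P, then some element satisfies Q.  Otherwise one
-- could walk backwards for ever, but a walk of m steps in Fin m closes a cycle.
module AcyclicDescent {m : ℕ} (R : Fin m → Fin m → Set)
                      (acyclic : ∀ x → ¬ TransClosure R x x) where

  record Walk (k : ℕ) (c : Fin m) : Set where
    field
      vertex : ℕ → Fin m
      start  : vertex 0 ≡ c
      edge   : ∀ {i} → i < k → R (vertex (suc i)) (vertex i)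

  prepend : ∀ {k z c} → R z c → Walk k z → Walk (suc k) c
  prepend {c = c} zRc w = record { vertex = vertex′ ; start = refl ; edge = edge′ }
    where
    open Walk w
    vertex′ : ℕ → Fin m
    vertex′ zero    = c
    vertex′ (suc i) = vertex i
    edge′ : ∀ {i} → i < suc _ → R (vertex′ (suc i)) (vertex′ i)
    edge′ {zero}  _         = subst (λ v → R v c) (sym start) zRc
    edge′ {suc i} (s≤s i<k) = edge i<k

  walk-path : ∀ {k c} (w : Walk k c) {i j} → i < j → j ≤ k
            → TransClosure R (Walk.vertex w j) (Walk.vertex w i)
  walk-path w {i} {suc j} (s≤s i≤j) j<k with m≤n⇒m<n∨m≡n i≤j
  ... | inj₁ i<j  = Walk.edge w j<k ∷ walk-path w i<j (<⇒≤ j<k)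
  ... | inj₂ refl = [ Walk.edge w j<k ]

  -- a walk of m steps visits m + 1 vertices of Fin m, hence repeats one
  no-long-walk : ∀ {c} → ¬ Walk m c
  no-long-walk w with pigeonhole (n<1+n m) (λ i → Walk.vertex w (toℕ i))
  ... | i , j , i<j , same =
    acyclic _ (subst (λ v → TransClosure R v (Walk.vertex w (toℕ i))) (sym same)
                     (walk-path w i<j (≤-pred (toℕ<n j))))

  module _ {P Q : Fin m → Set} (step : ∀ c → P c → Q c ⊎ ∃ λ z → P z × R z c) where

    descend : ∀ k {c} → P c → ∃ Q ⊎ Walk k c
    descend zero    {c} _  = inj₂ (record { vertex = λ _ → c ; start = refl ; edge = λ () })
    descend (suc k) {c} pc with step c pc
    ... | inj₁ qc = inj₁ (c , qc)
    ... | inj₂ (z , pz , zRc) with descend k pz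
    ...   | inj₁ found = inj₁ found
    ...   | inj₂ walk  = inj₂ (prepend zRc walk)

    descent : ∀ {c} → P c → ∃ Q
    descent pc with descend m pc
    ... | inj₁ found = found
    ... | inj₂ walk  = ⊥-elim (no-long-walk walk)

module Peeling (G : ValuedDigraph) where

  N : ℕ
  N = n G

  out : Fin N → Subset N
  out y = tabulate (E G y)

  arc⇒∈out : ∀ {y u} → E G y u ≡ true → u ∈ out y
  arc⇒∈out {y} {u} arc = lookup⇒[]= u (out y) (trans (lookup∘tabulate (E G y) u) arc)

  no-arc⇒∉out : ∀ {y u} → E G y u ≡ false → u ∉ out y
  no-arc⇒∉out {y} {u} no-arc u∈ with trans (sym ([]=⇒lookup u∈)) (trans (lookup∘tabulate (E G y) u) no-arc)
  ... | ()

  loss : Fin N → Subset N → ℕ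
  loss y D = ∣ out y ∩ D ∣

  loss-⊥ : ∀ y → loss y ⊥ ≡ 0
  loss-⊥ y = trans (cong ∣_∣ (∩-zeroʳ (out y))) (∣⊥∣≡0 N)

  loss-insert-arc : ∀ {y x D} → E G y x ≡ true → x ∉ D → loss y (⁅ x ⁆ ∪ D) ≡ suc (loss y D)
  loss-insert-arc arc x∉D = ∣p∩⁅x⁆∪q∣-∈ (arc⇒∈out arc) x∉D

  loss-insert-no-arc : ∀ {y x D} → E G y x ≡ false → loss y (⁅ x ⁆ ∪ D) ≡ loss y D
  loss-insert-no-arc no-arc = ∣p∩⁅x⁆∪q∣-∉ (no-arc⇒∉out no-arc)

  loss-mono : ∀ {y D D′} → D ⊆ D′ → loss y D ≤ loss y D′
  loss-mono {y} D⊆D′ = p⊆q⇒∣p∣≤∣q∣ (∩-monoʳ-⊆ {p = out y} D⊆D′)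

  loss-strict : ∀ {y c D D′} → D ⊆ D′ → c ∉ D → c ∈ D′ → E G y c ≡ true → loss y D < loss y D′
  loss-strict {y} {D = D} D⊆D′ c∉D c∈D′ arc = p⊂q⇒∣p∣<∣q∣
    (∩-monoʳ-⊆ {p = out y} D⊆D′ , _ , x∈p∩q⁺ (arc⇒∈out arc , c∈D′) ,
     λ c∈ → c∉D (proj₂ (x∈p∩q⁻ (out y) D c∈)))

  Exhausted : Subset N → Fin N → Set
  Exhausted D y = θ G y ≤ loss y D

  record Reached (s : State N) (D : Subset N) : Set where
    field
      alive⇒∉ : ∀ {y} → alive s y ≡ true → y ∉ D
      ∉⇒alive : ∀ {y} → y ∉ D → alive s y ≡ true
      val≡    : ∀ y → val s y ≡ θ G y ∸ loss y D
      bounded : ∀ {y} → y ∉ D → loss y D ≤ θ G y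

  open Reached

  val≡0⇒exhausted : ∀ {s D y} → Reached s D → val s y ≡ 0 → Exhausted D y
  val≡0⇒exhausted R v≡0 = m∸n≡0⇒m≤n (trans (sym (val≡ R _)) v≡0)

  exhausted⇒val≡0 : ∀ {s D y} → Reached s D → Exhausted D y → val s y ≡ 0
  exhausted⇒val≡0 R ex = trans (val≡ R _) (m≤n⇒m∸n≡0 ex)

  reached-initial : Reached (initial G) ⊥
  reached-initial = record
    { alive⇒∉ = λ _ → ∉⊥
    ; ∉⇒alive = λ _ → refl
    ; val≡    = λ y → sym (cong (θ G y ∸_) (loss-⊥ y))
    ; bounded = λ {y} _ → subst (_≤ θ G y) (sym (loss-⊥ y)) z≤n
    }

  -- Erasing x from a reached state reaches D with x inserted.  The bound is
  -- kept because every alive in-neighbour of x still has a positive value.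
  reached-delete : ∀ {s D x} → Reached s D → Erasable G s x → Reached (delete G s x) (⁅ x ⁆ ∪ D)
  reached-delete {s} {D} {x} R (x-alive , _ , unblocked) = record
    { alive⇒∉ = alive⇒∉′ ; ∉⇒alive = ∉⇒alive′ ; val≡ = val≡′ ; bounded = bounded′ }
    where
    x∉D : x ∉ D
    x∉D = alive⇒∉ R x-alive

    alive⇒∉′ : ∀ {y} → alive (delete G s x) y ≡ true → y ∉ ⁅ x ⁆ ∪ D
    alive⇒∉′ {y} al with y ≟ x
    alive⇒∉′ {y} () | yes _
    alive⇒∉′ {y} al | no y≢x = ∉-insert y≢x (alive⇒∉ R al)

    ∉⇒alive′ : ∀ {y} → y ∉ ⁅ x ⁆ ∪ D → alive (delete G s x) y ≡ true
    ∉⇒alive′ {y} y∉ with y ≟ x | ∉-insert⁻ y∉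
    ... | yes y≡x | y≢x , _   = ⊥-elim (y≢x y≡x)
    ... | no _    | _   , y∉D = ∉⇒alive R y∉D

    val≡′ : ∀ y → val (delete G s x) y ≡ θ G y ∸ loss y (⁅ x ⁆ ∪ D)
    val≡′ y with E G y x in arc
    ... | true = begin
      val s y ∸ 1                 ≡⟨ cong (_∸ 1) (val≡ R y) ⟩
      θ G y ∸ loss y D ∸ 1        ≡⟨ ∸-+-assoc (θ G y) (loss y D) 1 ⟩
      θ G y ∸ (loss y D + 1)      ≡⟨ cong (θ G y ∸_) (+-comm (loss y D) 1) ⟩
      θ G y ∸ suc (loss y D)      ≡⟨ cong (θ G y ∸_) (sym (loss-insert-arc arc x∉D)) ⟩
      θ G y ∸ loss y (⁅ x ⁆ ∪ D)  ∎
      where open ≡-Reasoning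
    ... | false = trans (val≡ R y) (cong (θ G y ∸_) (sym (loss-insert-no-arc arc)))

    bounded′ : ∀ {y} → y ∉ ⁅ x ⁆ ∪ D → loss y (⁅ x ⁆ ∪ D) ≤ θ G y
    bounded′ {y} y∉ with ∉-insert⁻ y∉ | E G y x in arc
    ... | _ , y∉D | false = subst (_≤ θ G y) (sym (loss-insert-no-arc arc)) (bounded R y∉D)
    ... | _ , y∉D | true  = subst (_≤ θ G y) (sym (loss-insert-arc arc x∉D)) (m∸n≢0⇒n<m
        (λ v≡0 → unblocked y (∉⇒alive R y∉D) arc (trans (val≡ R y) v≡0)))

  reached-run : ∀ {s D L t} → Reached s D → Run G s L t → Reached t (D ∪ setOf L)
  reached-run {D = D} R done = subst (Reached _) (sym (∪-identityʳ D)) R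
  reached-run {D = D} R (step {x = x} {xs} e r) =
    subst (Reached _) (insert-∪ x D (setOf xs)) (reached-run (reached-delete R e) r)

  -- A run erases pairwise distinct vertices outside the deleted set.
  card-run : ∀ {s D L t} → Reached s D → Run G s L t → ∣ D ∪ setOf L ∣ ≡ ∣ D ∣ + length L
  card-run {D = D} R done = trans (cong ∣_∣ (∪-identityʳ D)) (sym (+-identityʳ ∣ D ∣))
  card-run {D = D} R (step {x = x} {xs} e r) = begin
    ∣ D ∪ (⁅ x ⁆ ∪ setOf xs) ∣  ≡⟨ cong ∣_∣ (sym (insert-∪ x D (setOf xs))) ⟩
    ∣ (⁅ x ⁆ ∪ D) ∪ setOf xs ∣  ≡⟨ card-run (reached-delete R e) r ⟩
    ∣ ⁅ x ⁆ ∪ D ∣ + length xs   ≡⟨ cong (_+ length xs) (∣⁅x⁆∪p∣ (alive⇒∉ R (proj₁ e))) ⟩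
    suc ∣ D ∣ + length xs       ≡⟨ sym (+-suc ∣ D ∣ (length xs)) ⟩
    ∣ D ∣ + suc (length xs)     ∎
    where open ≡-Reasoning

  run-reached : ∀ {L t} → Run G (initial G) L t → Reached t (setOf L)
  run-reached r = subst (Reached _) (∪-identityˡ _) (reached-run reached-initial r)

  run-card : ∀ {L t} → Run G (initial G) L t → ∣ setOf L ∣ ≡ length L
  run-card {L} r = begin
    ∣ setOf L ∣            ≡⟨ cong ∣_∣ (sym (∪-identityˡ (setOf L))) ⟩
    ∣ ⊥ ∪ setOf L ∣        ≡⟨ card-run reached-initial r ⟩
    ∣ ⊥ {N} ∣ + length L   ≡⟨ cong (_+ length L) (∣⊥∣≡0 N) ⟩
    length L               ∎
    where open ≡-Reasoning

  run-++ : ∀ {s L t M u} → Run G s L t → Run G t M u → Run G s (L ++ M) u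
  run-++ done       r′ = r′
  run-++ (step e r) r′ = step e (run-++ r r′)

  run-prefix : ∀ {s L t} → Run G s L t → ∀ k → ∃ λ u → Run G s (take k L) u
  run-prefix r          zero    = _ , done
  run-prefix done       (suc k) = _ , done
  run-prefix (step e r) (suc k) with run-prefix r k
  ... | u , r′ = u , step e r′

  erasable? : ∀ s x → Dec (Erasable G s x)
  erasable? s x =
    (alive s x Bool.≟ true) ×-dec (val s x ℕ.≟ 0) ×-dec
    all? (λ z → (alive s z Bool.≟ true) →-dec ((E G z x Bool.≟ true) →-dec ¬? (val s z ℕ.≟ 0)))

  Stuck : State N → Set
  Stuck t = ∀ x → ¬ Erasable G t x

  -- It terminates: each step deletes a new vertex.
  greedy : (Good : Subset N → Set) (Done : State N → Subset N → Set)
         → (∀ {s D} → Reached s D → Good D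
              → Done s D ⊎ ∃ λ x → Erasable G s x × Good (⁅ x ⁆ ∪ D))
         → ∀ {s D} → Reached s D → Good D
         → ∃₂ λ M t → Run G s M t × Done t (D ∪ setOf M)
  greedy Good Done choose {D = D} R good = go N (m≤n+m N ∣ D ∣) R good
    where
    go : ∀ fuel {s D} → N ≤ ∣ D ∣ + fuel → Reached s D → Good D
       → ∃₂ λ M t → Run G s M t × Done t (D ∪ setOf M)
    go fuel {s} {D} bound R good with choose R good
    ... | inj₁ finished = [] , s , done , subst (Done s) (sym (∪-identityʳ D)) finished
    ... | inj₂ (x , e , good′) with fuel | ∣⁅x⁆∪p∣ {p = D} (alive⇒∉ R (proj₁ e))
    ...   | zero | grown = ⊥-elim (1+n≰n (begin
      suc ∣ D ∣      ≡⟨ sym grown ⟩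
      ∣ ⁅ x ⁆ ∪ D ∣  ≤⟨ ∣p∣≤n (⁅ x ⁆ ∪ D) ⟩
      N              ≤⟨ bound ⟩
      ∣ D ∣ + 0      ≡⟨ +-identityʳ ∣ D ∣ ⟩
      ∣ D ∣          ∎))
      where open ℕ.≤-Reasoning
    ...   | suc fuel | grown
      with go fuel (subst (N ≤_) (trans (+-suc ∣ D ∣ fuel) (cong (_+ fuel) (sym grown))) bound)
              (reached-delete R e) good′
    ...     | M , t , r , fin = x ∷ M , t , step e r , subst (Done t) (insert-∪ x D (setOf M)) fin

  complete : ∀ {s D} → Reached s D → ∃₂ λ M t → Run G s M t × Stuck t
  complete R = greedy (λ _ → ⊤′) (λ t _ → Stuck t) choose R tt
    where
    choose : ∀ {s D} → Reached s D → ⊤′ → Stuck s ⊎ ∃ λ x → Erasable G s x × ⊤′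
    choose {s} _ _ with any? (erasable? s)
    ... | yes (x , e) = inj₂ (x , e , tt)
    ... | no none     = inj₁ (λ x e → none (x , e))

  -- In a run from a state whose deleted set P lies in D, the first erased
  -- vertex outside D had value 0 when erased, so it is exhausted by D.
  first-outside : ∀ {s P D L t y} → Reached s P → P ⊆ D → Run G s L t
                → y ∈ setOf L → y ∉ D → ∃ λ x → x ∈ setOf L × x ∉ D × Exhausted D x
  first-outside R P⊆D done y∈⊥ y∉D = ⊥-elim (∉⊥ y∈⊥)
  first-outside {D = D} R P⊆D (step {x = x} e r) y∈L y∉D with x ∈? D
  ... | no x∉D = x , ∈-insert x , x∉D , ≤-trans (val≡0⇒exhausted R (proj₁ (proj₂ e))) (loss-mono P⊆D)
  ... | yes x∈D with ∈-insert⁻ y∈L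
  ...   | inj₁ refl = ⊥-elim (y∉D x∈D)
  ...   | inj₂ y∈xs with first-outside (reached-delete R e) (insert-⊆ x∈D P⊆D) r y∈xs y∉D
  ...     | x′ , x′∈xs , rest = x′ , x∈p∪q⁺ (inj₂ x′∈xs) , rest

  Candidate : Subset N → Subset N → Fin N → Set
  Candidate T D c = c ∈ T × c ∉ D × Exhausted D c

  -- A candidate is erasable unless an alive in-neighbour of value 0 blocks it;
  -- such a blocker z is again a candidate: if z ∉ T then, since the arc z → c
  -- enters T ∖ D, θ z ≤ loss z D < loss z T ≤ θ z.
  candidate-step : ∀ {s t D T} → Reached t T → Reached s D → D ⊆ T
                 → ∀ c → Candidate T D c
                 → (c ∈ T × Erasable G s c) ⊎ ∃ λ z → Candidate T D z × E G z c ≡ true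
  candidate-step {s} {T = T} RT RD D⊆T c (c∈T , c∉D , c-exh)
    with any? (λ z → (alive s z Bool.≟ true) ×-dec (E G z c Bool.≟ true) ×-dec (val s z ℕ.≟ 0))
  ... | no none =
    inj₁ (c∈T , ∉⇒alive RD c∉D , exhausted⇒val≡0 RD c-exh , λ z al arc v≡0 → none (z , al , arc , v≡0))
  ... | yes (z , z-alive , arc , v≡0) = inj₂ (z , (z∈T , alive⇒∉ RD z-alive , z-exh) , arc)
    where
    z-exh : Exhausted _ z
    z-exh = val≡0⇒exhausted RD v≡0
    z∈T : z ∈ T
    z∈T with z ∈? T
    ... | yes z∈T = z∈T
    ... | no  z∉T = ⊥-elim (1+n≰n
      (≤-trans (loss-strict D⊆T c∉D c∈T arc) (≤-trans (bounded RT z∉T) z-exh)))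

  find-erasable : ∀ {LT t s D y} → Run G (initial G) LT t → Reached s D → D ⊆ setOf LT
                → y ∈ setOf LT → y ∉ D → ∃ λ x → x ∈ setOf LT × Erasable G s x
  find-erasable rT RD D⊆T y∈T y∉D with first-outside reached-initial ⊥⊆ rT y∈T y∉D
  ... | c , candidate = AcyclicDescent.descent (λ z c → E G z c ≡ true) (acyclic G)
                          (candidate-step (run-reached rT) RD D⊆T) candidate

  extend : ∀ {LT t s D} → Run G (initial G) LT t → Reached s D → D ⊆ setOf LT
         → ∃₂ λ M u → Run G s M u × D ∪ setOf M ≡ setOf LT
  extend {LT} rT = greedy (_⊆ setOf LT) (λ _ D → D ≡ setOf LT) choose
    where
    choose : ∀ {s D} → Reached s D → D ⊆ setOf LT
           → D ≡ setOf LT ⊎ ∃ λ x → Erasable G s x × ⁅ x ⁆ ∪ D ⊆ setOf LT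
    choose {D = D} R D⊆T with ⊆-or-witness (setOf LT) D
    ... | inj₁ T⊆D = inj₁ (⊆-antisym D⊆T T⊆D)
    ... | inj₂ (y , y∈T , y∉D) with find-erasable rT R D⊆T y∈T y∉D
    ...   | x , x∈T , e = inj₂ (x , e , insert-⊆ x∈T D⊆T)

  IS⇒run : ∀ {A} → IS G A → ∃₂ λ L s → Run G (initial G) L s × A ≡ setOf L
  IS⇒run (inj₁ refl) = [] , initial G , done , refl
  IS⇒run (inj₂ (L , (_ , r , _) , k , _ , _ , A≡)) with run-prefix r k
  ... | s , r′ = take k L , s , r′ , A≡

  prefix-set : ∀ {P t} R → Run G (initial G) P t → setOf P ≡ setOf (take ∣ setOf P ∣ (P ++ R))
  prefix-set {P} R r rewrite run-card r | take-length-++ P R = refl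

  nested-peeling : ∀ (A B : Subset N) → IS G A → IS G B → A ⊆ B
                 → Σ (List (Fin N)) λ L → PeelingSequence G L
                     × A ≡ setOf (take ∣ A ∣ L) × B ≡ setOf (take ∣ B ∣ L)
  nested-peeling A B iA iB A⊆B with IS⇒run iA | IS⇒run iB
  ... | LA , _ , rA , refl | LB , _ , rB , refl with extend rB (run-reached rA) A⊆B
  ... | M , _ , rM , A∪M≡B with complete (run-reached (run-++ rA rM))
  ... | R , t , rR , stuck =
    (LA ++ M) ++ R , (t , run-++ (run-++ rA rM) rR , stuck) , A-prefix , B-prefix
    where
    A-prefix : setOf LA ≡ setOf (take ∣ setOf LA ∣ ((LA ++ M) ++ R))
    A-prefix = subst (λ L → setOf LA ≡ setOf (take ∣ setOf LA ∣ L)) (sym (++-assoc LA M R))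
                     (prefix-set (M ++ R) rA)
    B-prefix : setOf LB ≡ setOf (take ∣ setOf LB ∣ ((LA ++ M) ++ R))
    B-prefix = subst (λ S → S ≡ setOf (take ∣ S ∣ ((LA ++ M) ++ R)))
                     (trans (setOf-++ LA M) A∪M≡B) (prefix-set R (run-++ rA rM))

  -- Second part: if B covers A, then the prefix C of length |A| + 1 of the
  -- peeling sequence through A and B satisfies A ⊂ C ⊆ B, so C = B.
  covering-rank : ∀ A B → Covers G A B → ∣ B ∣ ≡ suc ∣ A ∣
  covering-rank A B (iA , iB , A⊆B , A≢B , between) with nested-peeling A B iA iB A⊆B
  ... | L , peel , A≡ , B≡ = squeeze (between C C∈IS A⊆C C⊆B)
    where
    prefix-card : ∀ k → ∣ setOf (take k L) ∣ ≡ k ⊓ length L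
    prefix-card k = trans (run-card (proj₂ (run-prefix (proj₁ (proj₂ peel)) k))) (length-take k L)

    A<B : ∣ A ∣ < ∣ B ∣
    A<B = ⊆∧≢⇒∣∣< A⊆B A≢B

    B≤L : ∣ B ∣ ≤ length L
    B≤L = subst (_≤ length L) (sym (trans (cong ∣_∣ B≡) (prefix-card ∣ B ∣))) (m⊓n≤n ∣ B ∣ (length L))

    C : Subset N
    C = setOf (take (suc ∣ A ∣) L)

    ∣C∣ : ∣ C ∣ ≡ suc ∣ A ∣
    ∣C∣ = trans (prefix-card (suc ∣ A ∣)) (m≤n⇒m⊓n≡m (≤-trans A<B B≤L))

    C∈IS : IS G C
    C∈IS = inj₂ (L , peel , suc ∣ A ∣ , s≤s z≤n , ≤-trans A<B B≤L , refl)

    A⊆C : A ⊆ C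
    A⊆C = subst (_⊆ C) (sym A≡) (setOf-take-mono L (n≤1+n ∣ A ∣))

    C⊆B : C ⊆ B
    C⊆B = subst (C ⊆_) (sym B≡) (setOf-take-mono L A<B)

    squeeze : C ≡ A ⊎ C ≡ B → ∣ B ∣ ≡ suc ∣ A ∣
    squeeze (inj₁ C≡A) = ⊥-elim (1+n≢n (trans (sym ∣C∣) (cong ∣_∣ C≡A)))
    squeeze (inj₂ C≡B) = trans (cong ∣_∣ (sym C≡B)) ∣C∣

proposition2 : (G : ValuedDigraph)
    → (∀ (A B : Subset (n G)) → IS G A → IS G B → A ⊆ B
         → Σ (List (Fin (n G))) λ L → PeelingSequence G L
             × A ≡ setOf (take ∣ A ∣ L) × B ≡ setOf (take ∣ B ∣ L))
    × GradedBy G ∣_∣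
proposition2 G = nested-peeling , (λ _ _ _ _ → ⊆∧≢⇒∣∣<) , covering-rank
  where open Peeling G
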